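{- Let $\mathbb{A} = \mathbb{R}[X_1,\ldots,X_k]$, $\mathbb{B} = \mathbb{R}[X_1^{\pm1},\ldots,X_k^{\pm1}]$, $\mathbb{A}^{++}$ the set of non-zero polynomials in $\mathbb{A}$ with non-negative coefficients, and $\mathbb{B}^{++}$ the set of non-zero Laurent polynomials in $\mathbb{B}$ with non-negative coefficients. Let $\boldsymbol{g}_1,\ldots,\boldsymbol{g}_m \in \mathbb{A}^n$, $\mathcal{M} = \boldsymbol{g}_1\mathbb{A}+\cdots+\boldsymbol{g}_m\mathbb{A}$ and $\mathcal{M}_{\mathbb{B}} = \boldsymbol{g}_1\mathbb{B}+\cdots+\boldsymbol{g}_m\mathbb{B}$. Then $\mathcal{M} \cap (\mathbb{A}^{++})^n \neq \emptyset$ if and only if $\mathcal{M}_{\mathbb{B}} \cap (\mathbb{B}^{++})^n \neq \emptyset$.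
   Context: For a commutative ring $R$, $\boldsymbol{g}_1R + \cdots + \boldsymbol{g}_mR = \{h_1\boldsymbol{g}_1 + \cdots + h_m\boldsymbol{g}_m \mid h_i \in R\}$ with componentwise scalar multiplication. -}

module Defs where

open import Level using (0ℓ)
open import Algebra.Bundles using (CommutativeRing)
open import Relation.Binary.Structures using (IsTotalOrder)
open import Relation.Binary.Definitions using (DecidableEquality)
open import Relation.Binary.PropositionalEquality using (_≡_)
open import Relation.Nullary using (¬_; yes; no)
open import Data.Product using (Σ; ∃; _×_; _,_)
open import Data.Nat as ℕ using (ℕ)
open import Data.Integer as ℤ using (ℤ)
open import Data.Fin using (Fin; zero; suc)
open import Data.List using (List; []; _∷_; _++_; map; concatMap)
open import Data.Vec as Vec using (Vec)
import Data.Vec.Properties as VecP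

-- The real numbers, axiomatised as a (Dedekind-)complete ordered field.
-- Any model is isomorphic to ℝ, so quantifying over all models is
-- the same as speaking about ℝ.

record RealField : Set₁ where
  field
    commRing : CommutativeRing 0ℓ 0ℓ
  open CommutativeRing commRing public
  field
    _≤_          : Carrier → Carrier → Set
    isTotalOrder : IsTotalOrder _≈_ _≤_
    +-mono-≤     : ∀ {x y} z → x ≤ y → (x + z) ≤ (y + z)
    *-nonneg     : ∀ {x y} → 0# ≤ x → 0# ≤ y → 0# ≤ (x * y)
    1≉0          : ¬ (1# ≈ 0#)
    inverse      : ∀ x → ¬ (x ≈ 0#) → ∃ λ y → (x * y) ≈ 1#
    complete     : (P : Carrier → Set) → ∃ P →
                   (∃ λ b → ∀ x → P x → x ≤ b) →
                   ∃ λ s → (∀ x → P x → x ≤ s) ×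
                           (∀ b → (∀ x → P x → x ≤ b) → s ≤ b)

-- (Laurent) polynomials as formal finite sums of terms  c · X^e,
-- generic in the exponent monoid E (Vec ℕ k or Vec ℤ k).
-- Two formal sums denote the same polynomial iff all coefficients agree.

module FormalSums (ℝ : RealField) (E : Set) (_≟E_ : DecidableEquality E)
                  (_⊕_ : E → E → E) where
  open RealField ℝ using (Carrier; _≈_; _≤_; 0#; _+_; _*_)

  Term : Set
  Term = Carrier × E

  Poly : Set
  Poly = List Term

  coeff : Poly → E → Carrier
  coeff [] e = 0#
  coeff ((c , f) ∷ p) e with f ≟E e
  ... | yes _ = c + coeff p e
  ... | no  _ = coeff p e

  _+ₚ_ : Poly → Poly → Poly
  p +ₚ q = p ++ q

  _*ₚ_ : Poly → Poly → Poly
  p *ₚ q = concatMap (λ { (a , e) → map (λ { (b , f) → (a * b , e ⊕ f) }) q }) p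

  Positive : Poly → Set
  Positive p = (∀ e → 0# ≤ coeff p e) × (∃ λ e → ¬ (coeff p e ≈ 0#))

  combo : ∀ {m n} → (Fin m → Fin n → Poly) → (Fin m → Poly) → Fin n → Poly
  combo {ℕ.zero}  g h j = []
  combo {ℕ.suc m} g h j = (h zero *ₚ g zero j) +ₚ combo (λ i → g (suc i)) (λ i → h (suc i)) j

  MeetsPositive : ∀ {m n} → (Fin m → Fin n → Poly) → Set
  MeetsPositive {m} {n} g = ∃ λ (h : Fin m → Poly) → ∀ j → Positive (combo g h j)

module Polynomials (ℝ : RealField) (k : ℕ) where
  module A = FormalSums ℝ (Vec ℕ k) (VecP.≡-dec ℕ._≟_) (Vec.zipWith ℕ._+_)
  module B = FormalSums ℝ (Vec ℤ k) (VecP.≡-dec ℤ._≟_) (Vec.zipWith ℤ._+_)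

  embed : A.Poly → B.Poly
  embed = map (λ { (c , e) → (c , Vec.map ℤ.+_ e) })

PolyA : RealField → ℕ → Set
PolyA ℝ k = Polynomials.A.Poly ℝ k

MeetsPositiveA : (ℝ : RealField) (k : ℕ) {m n : ℕ} → (Fin m → Fin n → PolyA ℝ k) → Set
MeetsPositiveA ℝ k g = Polynomials.A.MeetsPositive ℝ k g

MeetsPositiveB : (ℝ : RealField) (k : ℕ) {m n : ℕ} → (Fin m → Fin n → PolyA ℝ k) → Set
MeetsPositiveB ℝ k g = Polynomials.B.MeetsPositive ℝ k (λ i j → Polynomials.embed ℝ k (g i j))

{-# OPTIONS --safe #-}
-- A polynomial combination stays a polynomial combination in 𝔹, and the
-- inclusion 𝔸 ⊆ 𝔹 preserves and reflects positivity, so one direction is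
-- immediate.  Conversely, if h₁ g₁ + ⋯ + h_m g_m is positive for Laurent
-- polynomials h_i, multiply every h_i by the monomial X₁^N ⋯ X_k^N with N
-- larger than every negative exponent occurring in the h_i: the new
-- multipliers are ordinary polynomials, and multiplying by a monomial only
-- translates the exponents, which does not affect positivity.
module Submission where

open import Defs
open import Data.Nat using (ℕ)
open import Data.Fin using (Fin)
open import Function.Bundles using (_⇔_)

open import Function using (_∘_; id)
open import Function.Bundles using (mk⇔; Equivalence)
open import Function.Definitions using (Injective)
open import Data.Nat as ℕ using (zero; suc)
import Data.Nat.Properties as ℕP
open import Data.Integer as ℤ using (ℤ; -[1+_])
import Data.Integer.Properties as ℤP
import Data.Fin as Fin
open import Data.List using (List; []; _∷_; _++_; map; concatMap)
open import Data.List.Properties using (map-++; map-∘; map-cong; map-id; map-concatMap; concatMap-map; concatMap-cong)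
open import Data.Vec as Vec using (Vec; []; _∷_; zipWith; replicate)
import Data.Vec.Properties as VecP
open import Data.Product using (∃; _×_; _,_; map₂′)
open import Data.Empty using (⊥-elim)
open import Relation.Binary.PropositionalEquality
open import Relation.Binary.Definitions using (DecidableEquality)
open import Relation.Binary.Structures using (IsTotalOrder)
open import Relation.Nullary using (¬_; Dec; yes; no)
open import Relation.Nullary.Decidable using (map′)

ι : ∀ {n} → Vec ℕ n → Vec ℤ n
ι e = Vec.map ℤ.+_ e

ι-injective : ∀ {n} → Injective _≡_ _≡_ (ι {n})
ι-injective {x = []}    {[]}    _  = refl
ι-injective {x = a ∷ e} {b ∷ f} eq =
  cong₂ _∷_ (ℤP.+-injective (VecP.∷-injectiveˡ eq)) (ι-injective (VecP.∷-injectiveʳ eq))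

ι-+ : ∀ {n} (e f : Vec ℕ n) → ι (zipWith ℕ._+_ e f) ≡ zipWith ℤ._+_ (ι e) (ι f)
ι-+ []      []      = refl
ι-+ (a ∷ e) (b ∷ f) = cong (ℤ.+ (a ℕ.+ b) ∷_) (ι-+ e f)

ι-image? : ∀ {n} (f : Vec ℤ n) → Dec (∃ λ e → ι e ≡ f)
ι-image? []               = yes ([] , refl)
ι-image? (-[1+ _ ] ∷ _)   = no λ { (_ ∷ _ , ()) }
ι-image? (ℤ.+ a ∷ f)      = map′ (λ { (e , refl) → a ∷ e , refl })
                                 (λ { (_ ∷ e , refl) → e , refl })
                                 (ι-image? f)

_+ᵛ_ : ∀ {n} → Vec ℤ n → Vec ℤ n → Vec ℤ n
_+ᵛ_ = zipWith ℤ._+_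

-ᵛ_ : ∀ {n} → Vec ℤ n → Vec ℤ n
-ᵛ c = Vec.map ℤ.-_ c

+ᵛ-swapʳ : ∀ {n} (e f c : Vec ℤ n) → (e +ᵛ f) +ᵛ c ≡ (e +ᵛ c) +ᵛ f
+ᵛ-swapʳ e f c = begin
  (e +ᵛ f) +ᵛ c ≡⟨ VecP.zipWith-assoc ℤP.+-assoc e f c ⟩
  e +ᵛ (f +ᵛ c) ≡⟨ cong (e +ᵛ_) (VecP.zipWith-comm ℤP.+-comm f c) ⟩
  e +ᵛ (c +ᵛ f) ≡⟨ VecP.zipWith-assoc ℤP.+-assoc e c f ⟨
  (e +ᵛ c) +ᵛ f ∎
  where open ≡-Reasoning

+ᵛ-cancelʳ : ∀ {n} (e c d : Vec ℤ n) → c +ᵛ d ≡ replicate n ℤ.0ℤ → (e +ᵛ c) +ᵛ d ≡ e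
+ᵛ-cancelʳ e c d c+d≡0 = begin
  (e +ᵛ c) +ᵛ d        ≡⟨ VecP.zipWith-assoc ℤP.+-assoc e c d ⟩
  e +ᵛ (c +ᵛ d)        ≡⟨ cong (e +ᵛ_) c+d≡0 ⟩
  e +ᵛ replicate _ ℤ.0ℤ ≡⟨ VecP.zipWith-identityʳ ℤP.+-identityʳ e ⟩
  e                    ∎
  where open ≡-Reasoning

+ᵛ-injectiveˡ : ∀ {n} (c : Vec ℤ n) → Injective _≡_ _≡_ (_+ᵛ c)
+ᵛ-injectiveˡ c {e} {f} eq = begin
  e                  ≡⟨ +ᵛ-cancelʳ e c (-ᵛ c) c-c≡0 ⟨
  (e +ᵛ c) +ᵛ (-ᵛ c) ≡⟨ cong (_+ᵛ (-ᵛ c)) eq ⟩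
  (f +ᵛ c) +ᵛ (-ᵛ c) ≡⟨ +ᵛ-cancelʳ f c (-ᵛ c) c-c≡0 ⟩
  f                  ∎
  where
  open ≡-Reasoning
  c-c≡0 = VecP.zipWith-inverseʳ ℤP.+-inverseʳ c

+ᵛ-image? : ∀ {n} (c f : Vec ℤ n) → Dec (∃ λ e → e +ᵛ c ≡ f)
+ᵛ-image? c f = yes (f +ᵛ (-ᵛ c) , +ᵛ-cancelʳ f (-ᵛ c) c (VecP.zipWith-inverseˡ ℤP.+-inverseˡ c))

reindex : {C E F : Set} → (E → F) → List (C × E) → List (C × F)
reindex σ = map (map₂′ σ)

module Reindexing (ℝ : RealField) {E F : Set}
                  (_≟E_ : DecidableEquality E) (_⊕E_ : E → E → E)
                  (_≟F_ : DecidableEquality F) (_⊕F_ : F → F → F) where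
  open RealField ℝ using (_≈_; _≉_; _≤_; 0#; _+_; _*_; isTotalOrder) renaming (refl to ≈-refl)
  open IsTotalOrder isTotalOrder using () renaming (refl to ≤-refl)
  private
    module P = FormalSums ℝ E _≟E_ _⊕E_
    module Q = FormalSums ℝ F _≟F_ _⊕F_

  -- σ reindexes the multiplier and τ the other factor; a translation σ = (_+ᵛ c) pairs with τ = id.
  Homomorphic : (E → F) → (E → F) → Set
  Homomorphic σ τ = ∀ e f → σ (e ⊕E f) ≡ σ e ⊕F τ f

  reindex-*ₚ : (σ τ : E → F) → Homomorphic σ τ → ∀ p q →
               reindex σ (p P.*ₚ q) ≡ reindex σ p Q.*ₚ reindex τ q
  reindex-*ₚ σ τ hom p q = begin
    map (map₂′ σ) (concatMap _ p) ≡⟨ map-concatMap (map₂′ σ) _ p ⟩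
    concatMap _ p                ≡⟨ concatMap-cong (λ { (a , e) → termwise a e }) p ⟩
    concatMap _ p                ≡⟨ concatMap-map _ (map₂′ σ) p ⟨
    reindex σ p Q.*ₚ reindex τ q ∎
    where
    open ≡-Reasoning
    termwise : ∀ a e →
      reindex σ (map (λ { (b , f) → (a * b , e ⊕E f) }) q) ≡
      map (λ { (b , f) → (a * b , σ e ⊕F f) }) (reindex τ q)
    termwise a e = begin
      map _ (map _ q) ≡⟨ map-∘ q ⟨
      map _ q         ≡⟨ map-cong (λ { (b , f) → cong (a * b ,_) (hom e f) }) q ⟩
      map _ q         ≡⟨ map-∘ q ⟩
      map _ (map _ q) ∎

  reindex-combo : (σ τ : E → F) → Homomorphic σ τ →
                  ∀ {m n} (g : Fin m → Fin n → P.Poly) (h : Fin m → P.Poly) j →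
                  reindex σ (P.combo g h j) ≡
                  Q.combo (λ i j → reindex τ (g i j)) (λ i → reindex σ (h i)) j
  reindex-combo σ τ hom {zero}  g h j = refl
  reindex-combo σ τ hom {suc m} g h j = begin
    reindex σ (h Fin.zero P.*ₚ g Fin.zero j ++ P.combo (g ∘ Fin.suc) (h ∘ Fin.suc) j)
      ≡⟨ map-++ (map₂′ σ) (h Fin.zero P.*ₚ g Fin.zero j) _ ⟩
    reindex σ (h Fin.zero P.*ₚ g Fin.zero j) ++ reindex σ (P.combo (g ∘ Fin.suc) (h ∘ Fin.suc) j)
      ≡⟨ cong₂ _++_ (reindex-*ₚ σ τ hom (h Fin.zero) (g Fin.zero j))
                    (reindex-combo σ τ hom (g ∘ Fin.suc) (h ∘ Fin.suc) j) ⟩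
    Q.combo (λ i j → reindex τ (g i j)) (λ i → reindex σ (h i)) j ∎
    where open ≡-Reasoning

  coeff-reindex : (σ : E → F) → Injective _≡_ _≡_ σ →
                  ∀ p e → Q.coeff (reindex σ p) (σ e) ≡ P.coeff p e
  coeff-reindex σ σ-inj [] e = refl
  coeff-reindex σ σ-inj ((c , f) ∷ p) e with f ≟E e | σ f ≟F σ e
  ... | yes _    | yes _     = cong (c +_) (coeff-reindex σ σ-inj p e)
  ... | no _     | no _      = coeff-reindex σ σ-inj p e
  ... | yes f≡e  | no σf≢σe  = ⊥-elim (σf≢σe (cong σ f≡e))
  ... | no f≢e   | yes σf≡σe = ⊥-elim (f≢e (σ-inj σf≡σe))

  coeff-reindex-∉ : (σ : E → F) (p : P.Poly) (f : F) → ¬ (∃ λ e → σ e ≡ f) →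
                    Q.coeff (reindex σ p) f ≡ 0#
  coeff-reindex-∉ σ [] f f∉σ = refl
  coeff-reindex-∉ σ ((c , e) ∷ p) f f∉σ with σ e ≟F f
  ... | yes σe≡f = ⊥-elim (f∉σ (e , σe≡f))
  ... | no _     = coeff-reindex-∉ σ p f f∉σ

  Positive-reindex : (σ : E → F) → Injective _≡_ _≡_ σ → (∀ f → Dec (∃ λ e → σ e ≡ f)) →
                     ∀ p → P.Positive p ⇔ Q.Positive (reindex σ p)
  Positive-reindex σ σ-inj image? p = mk⇔ to from
    where
    coeff-σ = coeff-reindex σ σ-inj p

    to : P.Positive p → Q.Positive (reindex σ p)
    to (nonneg , e , nonzero) = nonneg′ , σ e , nonzero ∘ subst (_≈ 0#) (coeff-σ e)
      where
      nonneg′ : ∀ f → 0# ≤ Q.coeff (reindex σ p) f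
      nonneg′ f with image? f
      ... | yes (e′ , refl) = subst (0# ≤_) (sym (coeff-σ e′)) (nonneg e′)
      ... | no f∉σ = subst (0# ≤_) (sym (coeff-reindex-∉ σ p f f∉σ)) ≤-refl

    from : Q.Positive (reindex σ p) → P.Positive p
    from (nonneg , f , nonzero) = subst (0# ≤_) (coeff-σ _) ∘ nonneg ∘ σ , witness (image? f)
      where
      witness : Dec (∃ λ e → σ e ≡ f) → ∃ λ e → P.coeff p e ≉ 0#
      witness (yes (e , refl)) = e , nonzero ∘ subst (_≈ 0#) (sym (coeff-σ e))
      witness (no f∉σ) =
        ⊥-elim (nonzero (subst (_≈ 0#) (sym (coeff-reindex-∉ σ p f f∉σ)) ≈-refl))

module Combination (ℝ : RealField) {E : Set} (_≟_ : DecidableEquality E) (_⊕_ : E → E → E) where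
  open FormalSums ℝ E _≟_ _⊕_

  combo-cong : ∀ {m n} {g g′ : Fin m → Fin n → Poly} {h h′ : Fin m → Poly} →
               (∀ i j → g i j ≡ g′ i j) → (∀ i → h i ≡ h′ i) → ∀ j → combo g h j ≡ combo g′ h′ j
  combo-cong {zero}  g≡g′ h≡h′ j = refl
  combo-cong {suc m} g≡g′ h≡h′ j =
    cong₂ _++_ (cong₂ _*ₚ_ (h≡h′ Fin.zero) (g≡g′ Fin.zero j))
               (combo-cong (g≡g′ ∘ Fin.suc) (h≡h′ ∘ Fin.suc) j)

∥_∥₁ : ∀ {n} → Vec ℤ n → ℕ
∥ []    ∥₁ = 0
∥ z ∷ e ∥₁ = ℤ.∣ z ∣ ℕ.+ ∥ e ∥₁

module _ {C : Set} {n : ℕ} where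
  exponentBound : List (C × Vec ℤ n) → ℕ
  exponentBound []            = 0
  exponentBound ((_ , e) ∷ p) = ∥ e ∥₁ ℕ.+ exponentBound p

  familyBound : ∀ {m} → (Fin m → List (C × Vec ℤ n)) → ℕ
  familyBound {zero}  _ = 0
  familyBound {suc m} H = exponentBound (H Fin.zero) ℕ.+ familyBound (H ∘ Fin.suc)

  exponentBound≤familyBound : ∀ {m} (H : Fin m → List (C × Vec ℤ n)) i →
                              exponentBound (H i) ℕ.≤ familyBound H
  exponentBound≤familyBound H Fin.zero    = ℕP.m≤m+n _ _
  exponentBound≤familyBound H (Fin.suc i) =
    ℕP.≤-trans (exponentBound≤familyBound (H ∘ Fin.suc) i) (ℕP.m≤n+m _ (exponentBound (H Fin.zero)))

-- ∣ z + N ∣ equals z + N only when N ≥ ∣ z ∣; below that it is a junk value.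
clearNegative : ∀ {n} → ℕ → Vec ℤ n → Vec ℕ n
clearNegative N = Vec.map λ z → ℤ.∣ z ℤ.+ ℤ.+ N ∣

+∣z+N∣≡z+N : ∀ {N} z → ℤ.∣ z ∣ ℕ.≤ N → ℤ.+ ℤ.∣ z ℤ.+ ℤ.+ N ∣ ≡ z ℤ.+ ℤ.+ N
+∣z+N∣≡z+N (ℤ.+ _)    _   = refl
+∣z+N∣≡z+N -[1+ _ ] z≤N rewrite ℤP.⊖-≥ z≤N = refl

ι-clearNegative : ∀ {n N} (e : Vec ℤ n) → ∥ e ∥₁ ℕ.≤ N →
                  ι (clearNegative N e) ≡ e +ᵛ replicate n (ℤ.+ N)
ι-clearNegative []      _ = refl
ι-clearNegative (z ∷ e) ∥z∷e∥≤N = cong₂ _∷_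
  (+∣z+N∣≡z+N z (ℕP.m+n≤o⇒m≤o _ ∥z∷e∥≤N)) (ι-clearNegative e (ℕP.m+n≤o⇒n≤o ℤ.∣ z ∣ ∥z∷e∥≤N))

reindex-ι-clearNegative : ∀ {C : Set} {n N} (p : List (C × Vec ℤ n)) → exponentBound p ℕ.≤ N →
  reindex ι (reindex (clearNegative N) p) ≡ reindex (_+ᵛ replicate n (ℤ.+ N)) p
reindex-ι-clearNegative []            _ = refl
reindex-ι-clearNegative ((c , e) ∷ p) bound≤N = cong₂ _∷_
  (cong (c ,_) (ι-clearNegative e (ℕP.m+n≤o⇒m≤o _ bound≤N)))
  (reindex-ι-clearNegative p (ℕP.m+n≤o⇒n≤o ∥ e ∥₁ bound≤N))

module _ (ℝ : RealField) (k : ℕ) where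
  open Polynomials ℝ k
  private
    module AB = Reindexing ℝ {Vec ℕ k} {Vec ℤ k}
                  (VecP.≡-dec ℕ._≟_) (zipWith ℕ._+_) (VecP.≡-dec ℤ._≟_) (zipWith ℤ._+_)
    module BB = Reindexing ℝ {Vec ℤ k} {Vec ℤ k}
                  (VecP.≡-dec ℤ._≟_) (zipWith ℤ._+_) (VecP.≡-dec ℤ._≟_) (zipWith ℤ._+_)
    open Combination ℝ {Vec ℤ k} (VecP.≡-dec ℤ._≟_) (zipWith ℤ._+_)

  Positive-embed : ∀ p → A.Positive p ⇔ B.Positive (embed p)
  Positive-embed = AB.Positive-reindex ι ι-injective ι-image?

  embed-combo : ∀ {m n} (g : Fin m → Fin n → A.Poly) h j →
                embed (A.combo g h j) ≡ B.combo (λ i j → embed (g i j)) (embed ∘ h) j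
  embed-combo = AB.reindex-combo ι ι ι-+

  Positive-translate : ∀ (c : Vec ℤ k) p → B.Positive p → B.Positive (reindex (_+ᵛ c) p)
  Positive-translate c p =
    Equivalence.to (BB.Positive-reindex (_+ᵛ c) (+ᵛ-injectiveˡ c) (+ᵛ-image? c) p)

  translate-combo : ∀ {m n} (c : Vec ℤ k) (G : Fin m → Fin n → B.Poly) H j →
                    reindex (_+ᵛ c) (B.combo G H j) ≡ B.combo G (reindex (_+ᵛ c) ∘ H) j
  translate-combo c G H j =
    trans (BB.reindex-combo (_+ᵛ c) id (λ e f → +ᵛ-swapʳ e f c) G H j)
          (combo-cong (λ i j → map-id (G i j)) (λ _ → refl) j)

  embed-combo-clearNegative : ∀ {m n} (g : Fin m → Fin n → A.Poly) (H : Fin m → B.Poly) j →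
    let N = familyBound H in
    embed (A.combo g (reindex (clearNegative N) ∘ H) j) ≡
    reindex (_+ᵛ replicate k (ℤ.+ N)) (B.combo (λ i j → embed (g i j)) H j)
  embed-combo-clearNegative g H j = begin
    embed (A.combo g h j)             ≡⟨ embed-combo g h j ⟩
    B.combo G (embed ∘ h) j           ≡⟨ combo-cong (λ _ _ → refl) h≡H+c j ⟩
    B.combo G (reindex (_+ᵛ c) ∘ H) j ≡⟨ translate-combo c G H j ⟨
    reindex (_+ᵛ c) (B.combo G H j)   ∎
    where
    open ≡-Reasoning
    G = λ i j → embed (g i j)
    c = replicate k (ℤ.+ familyBound H)
    h = reindex (clearNegative (familyBound H)) ∘ H
    h≡H+c : ∀ i → embed (h i) ≡ reindex (_+ᵛ c) (H i)
    h≡H+c i = reindex-ι-clearNegative (H i) (exponentBound≤familyBound H i)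

  meetsPositive-embed : ∀ {m n} (g : Fin m → Fin n → A.Poly) →
                        A.MeetsPositive g → B.MeetsPositive (λ i j → embed (g i j))
  meetsPositive-embed g (h , positive) =
    embed ∘ h , λ j →
    subst B.Positive (embed-combo g h j) (Equivalence.to (Positive-embed (A.combo g h j)) (positive j))

  meetsPositive-unembed : ∀ {m n} (g : Fin m → Fin n → A.Poly) →
                          B.MeetsPositive (λ i j → embed (g i j)) → A.MeetsPositive g
  meetsPositive-unembed g (H , positive) = h , λ j →
    Equivalence.from (Positive-embed (A.combo g h j))
      (subst B.Positive (sym (embed-combo-clearNegative g H j))
             (Positive-translate c (B.combo (λ i j → embed (g i j)) H j) (positive j)))
    where
    c = replicate k (ℤ.+ familyBound H)
    h = reindex (clearNegative (familyBound H)) ∘ H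

lemma6p2 : (ℝ : RealField) (k n m : ℕ) (g : Fin m → Fin n → PolyA ℝ k) →
    MeetsPositiveA ℝ k g ⇔ MeetsPositiveB ℝ k g
lemma6p2 ℝ k n m g = mk⇔ (meetsPositive-embed ℝ k g) (meetsPositive-unembed ℝ k g)
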